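{- Let $q=p^{\alpha}$ be a prime power with $q\equiv 1\pmod 4$, and let $G=\operatorname{PSL}(2,q)$ act on $P$ as in the context. Then for every $\pi\in P$ the stabilizer $G_{\pi}$ is isomorphic to $C_p^{\alpha}\rtimes C_2$.
   Context: Let $\omega$ be a generator of $\mathbb{F}_q^{\times}$ and $i=\omega^{(q-1)/4}$. Let $P=(\mathbb{F}_q^2\setminus\{0\})/\langle i\rangle$, i.e. nonzero column vectors with $\pi,-\pi,i\pi,-i\pi$ identified. $G=\operatorname{PSL}(2,q)=\operatorname{SL}(2,q)/\{\pm I\}$ acts on $P$ by multiplying representatives. -}

module Defs where

open import Level using (0ℓ)
open import Data.Nat as ℕ using (ℕ; zero; suc)
open import Data.Nat.DivMod using (_/_)
open import Data.Fin using (Fin)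
open import Data.Bool using (Bool; true; false; _xor_)
open import Data.Integer as ℤ using (ℤ)
open import Data.Integer.Divisibility using () renaming (_∣_ to _∣ℤ_)
open import Data.Product using (Σ; ∃; _×_; _,_)
open import Data.Sum using (_⊎_)
open import Relation.Binary.PropositionalEquality using (_≡_; _≢_)
open import Relation.Nullary using (¬_)
open import Function.Bundles using (_↔_)
open import Algebra.Structures using (IsCommutativeRing)

record FiniteField (q : ℕ) : Set₁ where
  infixl 6 _+_
  infixl 7 _*_
  field
    Carrier : Set
    _+_ _*_ : Carrier → Carrier → Carrier
    -_      : Carrier → Carrier
    0# 1#   : Carrier
    isCommutativeRing : IsCommutativeRing _≡_ _+_ _*_ -_ 0# 1#
    0≢1     : 0# ≢ 1#
    inverse : ∀ x → x ≢ 0# → Σ Carrier (λ y → x * y ≡ 1#)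
    enum    : Carrier ↔ Fin q

module FieldOps {q : ℕ} (F : FiniteField q) where
  open FiniteField F public

  _^_ : Carrier → ℕ → Carrier
  x ^ zero  = 1#
  x ^ suc n = x * (x ^ n)

  IsGenerator : Carrier → Set
  IsGenerator ω = ω ≢ 0# × (∀ x → x ≢ 0# → Σ ℕ (λ k → ω ^ k ≡ x))

  iOf : Carrier → Carrier
  iOf ω = ω ^ ((q ℕ.∸ 1) / 4)

  Vec2 : Set
  Vec2 = Carrier × Carrier

  NonZeroVec : Vec2 → Set
  NonZeroVec (x , y) = ¬ (x ≡ 0# × y ≡ 0#)

  scale : Carrier → Vec2 → Vec2
  scale c (x , y) = (c * x , c * y)

  _~P_ : Carrier → Vec2 → Vec2 → Set
  _~P_ ω v w = Σ ℕ (λ k → w ≡ scale (iOf ω ^ k) v)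

  record Mat : Set where
    constructor mat
    field a b c d : Carrier

  det : Mat → Carrier
  det (mat a b c d) = a * d + (- (b * c))

  _·_ : Mat → Mat → Mat
  mat a b c d · mat a' b' c' d' =
    mat (a * a' + b * c') (a * b' + b * d') (c * a' + d * c') (c * b' + d * d')

  negM : Mat → Mat
  negM (mat a b c d) = mat (- a) (- b) (- c) (- d)

  act : Mat → Vec2 → Vec2
  act (mat a b c d) (x , y) = (a * x + b * y , c * x + d * y)

  InSL : Mat → Set
  InSL g = det g ≡ 1#

  _≈PSL_ : Mat → Mat → Set
  g ≈PSL h = h ≡ g ⊎ h ≡ negM g

  InStab : Carrier → Vec2 → Mat → Set
  InStab ω π g = InSL g × _~P_ ω π (act g π)

-- The group C_p^α ⋊ C_2, where the generator of C_2 acts on C_p^α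
-- by inversion.  C_p is modelled by ℤ modulo p, C_2 by Bool with xor.

SDCarrier : ℕ → Set
SDCarrier α = (Fin α → ℤ) × Bool

_≈SD_ : {p α : ℕ} → SDCarrier α → SDCarrier α → Set
_≈SD_ {p} (u , s) (v , t) = (∀ j → ℤ.+ p ∣ℤ (u j ℤ.- v j)) × s ≡ t

twist : Bool → ℤ → ℤ
twist false z = z
twist true  z = ℤ.- z

_∙SD_ : {α : ℕ} → SDCarrier α → SDCarrier α → SDCarrier α
(u , s) ∙SD (v , t) = ((λ j → u j ℤ.+ twist s (v j)) , s xor t)

record StabIso {q : ℕ} (F : FiniteField q) (ω : FiniteField.Carrier F)
               (π : FieldOps.Vec2 F) (p α : ℕ) : Set where
  open FieldOps F
  field
    f      : Mat → SDCarrier α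
    f-cong : ∀ g h → InStab ω π g → InStab ω π h →
             g ≈PSL h → _≈SD_ {p} (f g) (f h)
    f-hom  : ∀ g h → InStab ω π g → InStab ω π h →
             _≈SD_ {p} (f (g · h)) (f g ∙SD f h)
    f-inj  : ∀ g h → InStab ω π g → InStab ω π h →
             _≈SD_ {p} (f g) (f h) → g ≈PSL h
    f-surj : ∀ x → Σ Mat (λ g → InStab ω π g × _≈SD_ {p} (f g) x)

-- Complete π to a basis (π, e) of determinant 1.  In this basis an element of SL(2,q)
-- fixing the point [π] is upper triangular [[a, b], [0, a⁻¹]] with a = iᵏ, and a² = ±1
-- because i² = −1 (ω has order q − 1 = 4t and i = ωᵗ).  Multiplying two such matrices gives
-- b″a″ = ba + a²·b′a′, so g ↦ (ba, [a² = −1]) is a homomorphism onto (F_q, +) ⋊ C₂ with C₂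
-- acting by negation; its kernel is {±I}.  Finally (F_q, +) ≅ C_p^α by choosing a basis of
-- F_q over its prime field, whose characteristic must be p since q = p^α.

module Submission where

open import Defs
open import Data.Nat as ℕ using (ℕ; zero; suc; NonZero; _%_; _/_)
import Data.Nat.Properties as ℕₚ
open import Data.Nat.DivMod using (m≡m%n+[m/n]*n; m%n<n; m*n/n≡m)
open import Data.Nat.Divisibility as ℕ∣ using ()
open import Data.Nat.Primality using (Prime; prime⇒irreducible; prime⇒nonZero; prime⇒nonTrivial; euclidsLemma)
open import Data.Nat.Primality.Factorisation using (factorise; module PrimeFactorisation)
open import Data.Nat.Coprimality using (Coprime; coprime-Bézout)
open import Data.Nat.GCD using (module Bézout)
open import Data.Nat.ListAction using (product)
open import Data.Integer as ℤ using (ℤ; -[1+_]; _⊖_)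
import Data.Integer.Properties as ℤₚ
import Data.Integer.Divisibility as ℤ∣ᵤ
open import Data.Integer.Divisibility.Signed as ℤ∣ using (∣ᵤ⇒∣)
open import Data.Integer.DivMod using (_%ℕ_; _/ℕ_; a≡a%ℕn+[a/ℕn]*n; n%ℕd<d)
open import Data.Fin as Fin using (Fin; toℕ; fromℕ<; finToFun; funToFin; combine)
import Data.Fin.Properties as Finₚ
open import Data.Vec.Functional using (Vector; tail) renaming (_∷_ to _∷ᶠ_)
open import Data.List using ([]; _∷_)
open import Data.List.Relation.Unary.All using (All; []; _∷_)
open import Data.Bool using (Bool; true; false; _xor_)
open import Data.Maybe using (Maybe; just; nothing)
open import Data.Product using (Σ; _×_; _,_; proj₁; proj₂)
open import Data.Sum as Sum using (_⊎_; inj₁; inj₂)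
open import Data.Empty using (⊥-elim)
open import Relation.Nullary using (¬_; Dec; yes; no; does)
open import Relation.Binary.PropositionalEquality
open import Relation.Binary.Definitions using (DecidableEquality; tri<; tri≈; tri>)
open import Function.Bundles using (Inverse)
open import Algebra.Bundles using (CommutativeRing; Ring)
open import Algebra.Structures using (IsCommutativeRing)
import Algebra.Solver.Ring.AlmostCommutativeRing as AlmostCommutativeRing
import Algebra.Solver.Ring as RingSolver
import Algebra.Properties.Group as GroupProperties
import Algebra.Properties.AbelianGroup as AbelianGroupProperties
import Algebra.Properties.RingWithoutOne as RingWithoutOneProperties
import Algebra.Properties.Ring as RingProperties
import Algebra.Properties.Semiring.Mult as SemiringMultiples
import Algebra.Properties.Semiring.Sum as SemiringSums

-- Arithmetic in a finite field

module FieldLemmas {q : ℕ} (F : FiniteField q) where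
  open FieldOps F public
  open IsCommutativeRing isCommutativeRing public
    using (+-assoc; +-comm; *-assoc; +-identityˡ; +-identityʳ; *-identityˡ; *-identityʳ;
           -‿inverseˡ; -‿inverseʳ; zeroˡ; zeroʳ)

  commutativeRing : CommutativeRing _ _
  commutativeRing = record { isCommutativeRing = isCommutativeRing }

  open GroupProperties (CommutativeRing.+-group commutativeRing) public
    using (identityʳ-unique; inverseʳ-unique; x∙y⁻¹≈ε⇒x≈y; ⁻¹-involutive; ε⁻¹≈ε)
  open AbelianGroupProperties (CommutativeRing.+-abelianGroup commutativeRing)
    using (⁻¹-∙-comm)
  open RingWithoutOneProperties (Ring.ringWithoutOne (CommutativeRing.ring commutativeRing)) public
    using (-‿distribˡ-*; -‿distribʳ-*)
  open RingProperties (CommutativeRing.ring commutativeRing) public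
    using (-1*x≈-x)
  open SemiringMultiples (CommutativeRing.semiring commutativeRing)
    using (×-homo-+; ×1-homo-*) renaming (_×_ to _times_)

  fromℕ : ℕ → Carrier
  fromℕ n = n times 1#

  fromℤ : ℤ → Carrier
  fromℤ (ℤ.+ n)  = fromℕ n
  fromℤ -[1+ n ] = - fromℕ (suc n)

  fromℕ-+ : ∀ m n → fromℕ (m ℕ.+ n) ≡ fromℕ m + fromℕ n
  fromℕ-+ = ×-homo-+ 1#

  fromℕ-* : ∀ m n → fromℕ (m ℕ.* n) ≡ fromℕ m * fromℕ n
  fromℕ-* = ×1-homo-*

  fromℤ-⊖ : ∀ m n → fromℤ (m ⊖ n) ≡ fromℕ m + - fromℕ n
  fromℤ-⊖ m       zero    = sym (trans (cong (fromℕ m +_) ε⁻¹≈ε) (+-identityʳ _))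
  fromℤ-⊖ zero    (suc n) = sym (+-identityˡ _)
  fromℤ-⊖ (suc m) (suc n) = begin
    fromℤ (suc m ⊖ suc n)                   ≡⟨ cong fromℤ (ℤₚ.[1+m]⊖[1+n]≡m⊖n m n) ⟩
    fromℤ (m ⊖ n)                           ≡⟨ fromℤ-⊖ m n ⟩
    a + - b                                 ≡⟨ cong (_+ - b) (sym (+-identityˡ a)) ⟩
    (0# + a) + - b                          ≡⟨ cong (λ z → (z + a) + - b) (sym (-‿inverseˡ 1#)) ⟩
    ((- 1# + 1#) + a) + - b                 ≡⟨ cong (_+ - b) (+-assoc (- 1#) 1# a) ⟩
    (- 1# + (1# + a)) + - b                 ≡⟨ cong (_+ - b) (+-comm (- 1#) (1# + a)) ⟩
    ((1# + a) + - 1#) + - b                 ≡⟨ +-assoc (1# + a) (- 1#) (- b) ⟩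
    (1# + a) + (- 1# + - b)                 ≡⟨ cong ((1# + a) +_) (⁻¹-∙-comm 1# b) ⟩
    (1# + a) + - (1# + b)                   ∎
    where open ≡-Reasoning
          a : Carrier
          a = fromℕ m
          b : Carrier
          b = fromℕ n

  fromℤ-+ : ∀ i j → fromℤ (i ℤ.+ j) ≡ fromℤ i + fromℤ j
  fromℤ-+ (ℤ.+ m)  (ℤ.+ n)  = fromℕ-+ m n
  fromℤ-+ (ℤ.+ m)  -[1+ n ] = fromℤ-⊖ m (suc n)
  fromℤ-+ -[1+ m ] (ℤ.+ n)  = trans (fromℤ-⊖ n (suc m)) (+-comm _ _)
  fromℤ-+ -[1+ m ] -[1+ n ] = begin
    - fromℕ (suc (suc (m ℕ.+ n)))          ≡⟨ cong (λ k → - fromℕ (suc k)) (sym (ℕₚ.+-suc m n)) ⟩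
    - fromℕ (suc m ℕ.+ suc n)              ≡⟨ cong -_ (fromℕ-+ (suc m) (suc n)) ⟩
    - (fromℕ (suc m) + fromℕ (suc n))      ≡⟨ sym (⁻¹-∙-comm _ _) ⟩
    - fromℕ (suc m) + - fromℕ (suc n)      ∎
    where open ≡-Reasoning

  fromℤ-neg : ∀ i → fromℤ (ℤ.- i) ≡ - fromℤ i
  fromℤ-neg -[1+ n ]      = sym (⁻¹-involutive _)
  fromℤ-neg (ℤ.+ zero)    = sym ε⁻¹≈ε
  fromℤ-neg (ℤ.+ (suc n)) = refl

  private
    fromℤ-*-fromℕ : ∀ m j → fromℤ (ℤ.+ m ℤ.* j) ≡ fromℕ m * fromℤ j
    fromℤ-*-fromℕ m (ℤ.+ n)  = trans (cong fromℤ (sym (ℤₚ.pos-* m n))) (fromℕ-* m n)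
    fromℤ-*-fromℕ m -[1+ n ] = begin
      fromℤ (ℤ.+ m ℤ.* ℤ.- ℤ.+ suc n)      ≡⟨ cong fromℤ (sym (ℤₚ.neg-distribʳ-* (ℤ.+ m) (ℤ.+ suc n))) ⟩
      fromℤ (ℤ.- (ℤ.+ m ℤ.* ℤ.+ suc n))    ≡⟨ fromℤ-neg (ℤ.+ m ℤ.* ℤ.+ suc n) ⟩
      - fromℤ (ℤ.+ m ℤ.* ℤ.+ suc n)        ≡⟨ cong -_ (fromℤ-*-fromℕ m (ℤ.+ suc n)) ⟩
      - (fromℕ m * fromℕ (suc n))          ≡⟨ -‿distribʳ-* _ _ ⟩
      fromℕ m * - fromℕ (suc n)            ∎
      where open ≡-Reasoning

  fromℤ-* : ∀ i j → fromℤ (i ℤ.* j) ≡ fromℤ i * fromℤ j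
  fromℤ-* (ℤ.+ m)  j = fromℤ-*-fromℕ m j
  fromℤ-* -[1+ m ] j = begin
    fromℤ (ℤ.- ℤ.+ suc m ℤ.* j)            ≡⟨ cong fromℤ (sym (ℤₚ.neg-distribˡ-* (ℤ.+ suc m) j)) ⟩
    fromℤ (ℤ.- (ℤ.+ suc m ℤ.* j))          ≡⟨ fromℤ-neg (ℤ.+ suc m ℤ.* j) ⟩
    - fromℤ (ℤ.+ suc m ℤ.* j)              ≡⟨ cong -_ (fromℤ-*-fromℕ (suc m) j) ⟩
    - (fromℕ (suc m) * fromℤ j)            ≡⟨ -‿distribˡ-* _ _ ⟩
    - fromℕ (suc m) * fromℤ j              ∎
    where open ≡-Reasoning

  fromℤ-homomorphism : CommutativeRing.rawRing ℤₚ.+-*-commutativeRing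
    AlmostCommutativeRing.-Raw-AlmostCommutative⟶ AlmostCommutativeRing.fromCommutativeRing commutativeRing
  fromℤ-homomorphism = record
    { ⟦_⟧ = fromℤ ; +-homo = fromℤ-+ ; *-homo = fromℤ-* ; -‿homo = fromℤ-neg
    ; 0-homo = refl ; 1-homo = +-identityʳ 1# }

  fromℤ-≟ : ∀ i j → Maybe (fromℤ i ≡ fromℤ j)
  fromℤ-≟ i j with i ℤ.≟ j
  ... | yes refl = just refl
  ... | no _     = nothing

  -- The ring solver needs coefficients whose equality computes, so it works over ℤ via fromℤ.
  open RingSolver _ _ fromℤ-homomorphism fromℤ-≟ public
    using (solve; _:=_; _:+_; _:*_; :-_; con)

  module Enum = Inverse enum

  Enum-to-injective : ∀ {x y} → Enum.to x ≡ Enum.to y → x ≡ y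
  Enum-to-injective {x} {y} e =
    trans (sym (Enum.strictlyInverseʳ x)) (trans (cong Enum.from e) (Enum.strictlyInverseʳ y))

  Enum-from-injective : ∀ {i j} → Enum.from i ≡ Enum.from j → i ≡ j
  Enum-from-injective {i} {j} e =
    trans (sym (Enum.strictlyInverseˡ i)) (trans (cong Enum.to e) (Enum.strictlyInverseˡ j))

  infix 4 _≟_
  _≟_ : DecidableEquality Carrier
  x ≟ y with Enum.to x Fin.≟ Enum.to y
  ... | yes e = yes (Enum-to-injective e)
  ... | no ne = no (λ e → ne (cong Enum.to e))

  1≢0 : 1# ≢ 0#
  1≢0 e = 0≢1 (sym e)

  _⁻¹ : ∀ x → x ≢ 0# → Carrier
  (x ⁻¹) x≢0 = proj₁ (inverse x x≢0)

  *-inverseʳ : ∀ x (x≢0 : x ≢ 0#) → x * (x ⁻¹) x≢0 ≡ 1#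
  *-inverseʳ x x≢0 = proj₂ (inverse x x≢0)

  x≢0⇒xy≡0⇒y≡0 : ∀ {x y} → x ≢ 0# → x * y ≡ 0# → y ≡ 0#
  x≢0⇒xy≡0⇒y≡0 {x} {y} x≢0 xy≡0 = begin
    y               ≡⟨ sym (*-identityˡ y) ⟩
    1# * y          ≡⟨ cong (_* y) (sym (*-inverseʳ x x≢0)) ⟩
    (x * x⁻¹) * y   ≡⟨ solve 3 (λ x y x' → (x :* x') :* y := x' :* (x :* y)) refl x y x⁻¹ ⟩
    x⁻¹ * (x * y)   ≡⟨ cong (x⁻¹ *_) xy≡0 ⟩
    x⁻¹ * 0#        ≡⟨ zeroʳ x⁻¹ ⟩
    0#              ∎
    where open ≡-Reasoning
          x⁻¹ : Carrier
          x⁻¹ = (x ⁻¹) x≢0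

  *-nonZero : ∀ {x y} → x ≢ 0# → y ≢ 0# → x * y ≢ 0#
  *-nonZero x≢0 y≢0 xy≡0 = y≢0 (x≢0⇒xy≡0⇒y≡0 x≢0 xy≡0)

  *-cancelˡ : ∀ {x y z} → x ≢ 0# → x * y ≡ x * z → y ≡ z
  *-cancelˡ {x} {y} {z} x≢0 xy≡xz = x∙y⁻¹≈ε⇒x≈y y z (x≢0⇒xy≡0⇒y≡0 x≢0 (begin
    x * (y + - z)     ≡⟨ solve 3 (λ x y z → x :* (y :+ :- z) := x :* y :+ :- (x :* z)) refl x y z ⟩
    x * y + - (x * z) ≡⟨ cong (λ t → t + - (x * z)) xy≡xz ⟩
    x * z + - (x * z) ≡⟨ -‿inverseʳ (x * z) ⟩
    0#                ∎))
    where open ≡-Reasoning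

  ^-+ : ∀ x m n → x ^ (m ℕ.+ n) ≡ x ^ m * x ^ n
  ^-+ x zero    n = sym (*-identityˡ _)
  ^-+ x (suc m) n = trans (cong (x *_) (^-+ x m n)) (sym (*-assoc _ _ _))

  ^-* : ∀ x m n → x ^ (m ℕ.* n) ≡ (x ^ n) ^ m
  ^-* x zero    n = refl
  ^-* x (suc m) n = trans (^-+ x n (m ℕ.* n)) (cong (x ^ n *_) (^-* x m n))

  1^ : ∀ n → 1# ^ n ≡ 1#
  1^ zero    = refl
  1^ (suc n) = trans (*-identityˡ _) (1^ n)

  ^-nonZero : ∀ x n → x ≢ 0# → x ^ n ≢ 0#
  ^-nonZero x zero    x≢0 = 1≢0
  ^-nonZero x (suc n) x≢0 = *-nonZero x≢0 (^-nonZero x n x≢0)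

  q≢1 : q ≢ 1
  q≢1 q≡1 = 0≢1 (Enum-to-injective (Fin1-irrelevant q≡1 (Enum.to 0#) (Enum.to 1#)))
    where Fin1-irrelevant : ∀ {n} → n ≡ 1 → (i j : Fin n) → i ≡ j
          Fin1-irrelevant refl Fin.zero Fin.zero = refl

  ^-distribʳ-* : ∀ x y n → (x * y) ^ n ≡ x ^ n * y ^ n
  ^-distribʳ-* x y zero    = sym (*-identityˡ 1#)
  ^-distribʳ-* x y (suc n) = trans (cong ((x * y) *_) (^-distribʳ-* x y n))
    (solve 4 (λ x y a b → (x :* y) :* (a :* b) := (x :* a) :* (y :* b)) refl x y (x ^ n) (y ^ n))

  ^-%-periodic : ∀ x m k → x ^ suc m ≡ 1# → x ^ (k % suc m) ≡ x ^ k
  ^-%-periodic x m k x^[1+m]≡1 = sym (begin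
    x ^ k                                   ≡⟨ cong (x ^_) (m≡m%n+[m/n]*n k (suc m)) ⟩
    x ^ (k % suc m ℕ.+ (k / suc m) ℕ.* suc m) ≡⟨ ^-+ x (k % suc m) _ ⟩
    x ^ (k % suc m) * x ^ ((k / suc m) ℕ.* suc m) ≡⟨ cong (x ^ (k % suc m) *_) (^-* x (k / suc m) (suc m)) ⟩
    x ^ (k % suc m) * (x ^ suc m) ^ (k / suc m) ≡⟨ cong (λ y → x ^ (k % suc m) * y ^ (k / suc m)) x^[1+m]≡1 ⟩
    x ^ (k % suc m) * 1# ^ (k / suc m)       ≡⟨ cong (x ^ (k % suc m) *_) (1^ (k / suc m)) ⟩
    x ^ (k % suc m) * 1#                     ≡⟨ *-identityʳ _ ⟩
    x ^ (k % suc m)                          ∎)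
    where open ≡-Reasoning

  x*x≡y*y⇒x≡±y : ∀ x y → x * x ≡ y * y → x ≡ y ⊎ x ≡ - y
  x*x≡y*y⇒x≡±y x y x²≡y² with x ≟ y
  ... | yes x≡y = inj₁ x≡y
  ... | no  x≢y = inj₂ (inverseʳ-unique y x (trans (+-comm y x)
    (x≢0⇒xy≡0⇒y≡0 (λ x-y≡0 → x≢y (x∙y⁻¹≈ε⇒x≈y x y x-y≡0)) (begin
      (x + - y) * (x + y)     ≡⟨ solve 2 (λ x y → (x :+ :- y) :* (x :+ y) := x :* x :+ :- (y :* y)) refl x y ⟩
      x * x + - (y * y)       ≡⟨ cong (_+ - (y * y)) x²≡y² ⟩
      y * y + - (y * y)       ≡⟨ -‿inverseʳ (y * y) ⟩
      0#                      ∎))))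
    where open ≡-Reasoning

  ±1 : Bool → Carrier
  ±1 false = 1#
  ±1 true  = - 1#

  ±1-xor : ∀ s t → ±1 s * ±1 t ≡ ±1 (s xor t)
  ±1-xor false t     = *-identityˡ (±1 t)
  ±1-xor true  false = *-identityʳ (- 1#)
  ±1-xor true  true  = trans (solve 1 (λ o → (:- o) :* (:- o) := o :* o) refl 1#) (*-identityʳ 1#)

  ±1-≟ : ∀ x → x ≡ 1# ⊎ x ≡ - 1# → x ≡ ±1 (does (x ≟ - 1#))
  ±1-≟ x x≡±1 with x ≟ - 1# | x≡±1
  ... | yes x≡-1 | _         = x≡-1
  ... | no  _    | inj₁ x≡1  = x≡1
  ... | no  x≢-1 | inj₂ x≡-1 = ⊥-elim (x≢-1 x≡-1)

  ≟-±1 : 1# ≢ - 1# → ∀ s → does (±1 s ≟ - 1#) ≡ s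
  ≟-±1 1≢-1 false with 1# ≟ - 1#
  ... | yes 1≡-1 = ⊥-elim (1≢-1 1≡-1)
  ... | no  _    = refl
  ≟-±1 1≢-1 true with - 1# ≟ - 1#
  ... | yes _     = refl
  ... | no  -1≢-1 = ⊥-elim (-1≢-1 refl)

-- The additive group of F_q is C_p^α

_≋[_]_ : ∀ {k} → (Fin k → ℤ) → ℕ → (Fin k → ℤ) → Set
u ≋[ p ] v = ∀ j → ℤ.+ p ℤ∣ᵤ.∣ (u j ℤ.- v j)

prime∣^⇒prime∣ : ∀ {p m} k → Prime p → p ℕ∣.∣ m ℕ.^ k → p ℕ∣.∣ m
prime∣^⇒prime∣ zero    p-prime p∣1 = ⊥-elim (ℕ.nonTrivial⇒≢1 {{prime⇒nonTrivial p-prime}} (ℕ∣.∣1⇒≡1 p∣1))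
prime∣^⇒prime∣ {m = m} (suc k) p-prime p∣m*m^k with euclidsLemma m (m ℕ.^ k) p-prime p∣m*m^k
... | inj₁ p∣m   = p∣m
... | inj₂ p∣m^k = prime∣^⇒prime∣ k p-prime p∣m^k

^-injectiveʳ : ∀ {m a b} → 1 ℕ.< m → m ℕ.^ a ≡ m ℕ.^ b → a ≡ b
^-injectiveʳ {m} {a} {b} 1<m e with ℕₚ.<-cmp a b
... | tri< a<b _ _ = ⊥-elim (ℕₚ.<-irrefl e (ℕₚ.^-monoʳ-< m 1<m a<b))
... | tri≈ _ a≡b _ = a≡b
... | tri> _ _ b<a = ⊥-elim (ℕₚ.<-irrefl (sym e) (ℕₚ.^-monoʳ-< m 1<m b<a))

prime-power-injective : ∀ {p r a k} → Prime p → Prime r → p ℕ.^ suc a ≡ r ℕ.^ k → p ≡ r × suc a ≡ k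
prime-power-injective {p} {r} {a} {k} p-prime r-prime e =
  p≡r , ^-injectiveʳ (ℕ.nonTrivial⇒n>1 r {{prime⇒nonTrivial r-prime}}) (subst (λ b → b ℕ.^ suc a ≡ r ℕ.^ k) p≡r e)
  where
    p≡r : p ≡ r
    p≡r with prime⇒irreducible r-prime (prime∣^⇒prime∣ k p-prime (subst (p ℕ∣.∣_) e (ℕ∣.m∣m*n (p ℕ.^ a))))
    ... | inj₁ p≡1 = ⊥-elim (ℕ.nonTrivial⇒≢1 {{prime⇒nonTrivial p-prime}} p≡1)
    ... | inj₂ p≡r = p≡r

module PrimeSubfield {q : ℕ} (F : FiniteField q) where
  open FieldLemmas F
  open SemiringSums (CommutativeRing.semiring commutativeRing)
    using (sum; sum-cong-≗; ∑-distrib-+; *-distribˡ-sum)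

  lincomb : ∀ {k} → Vector Carrier k → (Fin k → ℤ) → Carrier
  lincomb v c = sum (λ j → fromℤ (c j) * v j)

  lincomb-cong : ∀ {k} (v : Vector Carrier k) c d → (∀ j → fromℤ (c j) ≡ fromℤ (d j)) →
                 lincomb v c ≡ lincomb v d
  lincomb-cong v c d c≗d = sum-cong-≗ (λ j → cong (_* v j) (c≗d j))

  lincomb-+ : ∀ {k} (v : Vector Carrier k) c d → lincomb v (λ j → c j ℤ.+ d j) ≡ lincomb v c + lincomb v d
  lincomb-+ v c d = trans
    (sum-cong-≗ {x = λ j → fromℤ (c j ℤ.+ d j) * v j} (λ j → trans (cong (_* v j) (fromℤ-+ (c j) (d j))) (distribʳ (v j) _ _)))
    (∑-distrib-+ (λ j → fromℤ (c j) * v j) (λ j → fromℤ (d j) * v j))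
    where open CommutativeRing commutativeRing using (distribʳ)

  lincomb-* : ∀ {k} (v : Vector Carrier k) m c → lincomb v (λ j → m ℤ.* c j) ≡ fromℤ m * lincomb v c
  lincomb-* v m c = trans
    (sum-cong-≗ {x = λ j → fromℤ (m ℤ.* c j) * v j} (λ j → trans (cong (_* v j) (fromℤ-* m (c j))) (*-assoc _ _ _)))
    (sym (*-distribˡ-sum (fromℤ m) (λ j → fromℤ (c j) * v j)))

  lincomb-neg : ∀ {k} (v : Vector Carrier k) c → lincomb v (λ j → ℤ.- c j) ≡ - lincomb v c
  lincomb-neg v c = begin
    lincomb v (λ j → ℤ.- c j)            ≡⟨ lincomb-cong v (λ j → ℤ.- c j) (λ j → ℤ.-1ℤ ℤ.* c j) (λ j → cong fromℤ (sym (ℤₚ.-1*i≡-i (c j)))) ⟩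
    lincomb v (λ j → ℤ.-1ℤ ℤ.* c j)      ≡⟨ lincomb-* v ℤ.-1ℤ c ⟩
    fromℤ ℤ.-1ℤ * lincomb v c            ≡⟨ solve 1 (λ x → con ℤ.-1ℤ :* x := :- x) refl (lincomb v c) ⟩
    - lincomb v c                        ∎
    where open ≡-Reasoning

  Spans : ∀ {k} → Vector Carrier k → Carrier → Set
  Spans {k} v x = Σ (Fin k → ℤ) λ c → lincomb v c ≡ x

  -- Linear independence over the prime field ℤ/r, with integer coefficients read modulo r.
  Independent : ∀ {k} → ℕ → Vector Carrier k → Set
  Independent r v = ∀ c → lincomb v c ≡ 0# → ∀ j → ℤ.+ r ℤ∣ᵤ.∣ c j

  lincomb-injective : ∀ {k r} (v : Vector Carrier k) → Independent r v →
                  ∀ c d → lincomb v c ≡ lincomb v d → c ≋[ r ] d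
  lincomb-injective v indep c d e = indep (λ j → c j ℤ.- d j) (begin
    lincomb v (λ j → c j ℤ.+ ℤ.- d j)     ≡⟨ lincomb-+ v c (λ j → ℤ.- d j) ⟩
    lincomb v c + lincomb v (λ j → ℤ.- d j) ≡⟨ cong₂ _+_ e (lincomb-neg v d) ⟩
    lincomb v d + - lincomb v d           ≡⟨ -‿inverseʳ (lincomb v d) ⟩
    0#                                    ∎)
    where open ≡-Reasoning

  record Basis (r k : ℕ) : Set where
    field
      vector      : Vector Carrier k
      independent : Independent r vector
      spanning    : ∀ x → Spans vector x

  fromℕ-vanishes : Σ ℕ λ d → NonZero d × fromℕ d ≡ 0#
  fromℕ-vanishes with Finₚ.pigeonhole (ℕₚ.n<1+n q) (λ (i : Fin (suc q)) → Enum.to (fromℕ (toℕ i)))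
  ... | i , j , i<j , e = d , ℕ.>-nonZero (ℕₚ.m<n⇒0<n∸m i<j) , identityʳ-unique (fromℕ (toℕ i)) (fromℕ d) (begin
    fromℕ (toℕ i) + fromℕ d       ≡⟨ sym (fromℕ-+ (toℕ i) d) ⟩
    fromℕ (toℕ i ℕ.+ d)           ≡⟨ cong fromℕ (ℕₚ.m+[n∸m]≡n (ℕₚ.<⇒≤ i<j)) ⟩
    fromℕ (toℕ j)                 ≡⟨ Enum-to-injective e ⟨
    fromℕ (toℕ i)                 ∎)
    where open ≡-Reasoning
          d : ℕ
          d = toℕ j ℕ.∸ toℕ i

  characteristic : Σ ℕ λ r → Prime r × fromℕ r ≡ 0#
  characteristic with fromℕ-vanishes
  ... | d , d≢0 , d↦0 = factor-vanishes factors factorsPrime (trans (cong fromℕ (sym isFactorisation)) d↦0)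
    where
      open PrimeFactorisation (factorise d {{d≢0}})
      factor-vanishes : ∀ ps → All Prime ps → fromℕ (product ps) ≡ 0# → Σ ℕ λ r → Prime r × fromℕ r ≡ 0#
      factor-vanishes []       []       e = ⊥-elim (1≢0 (trans (sym (+-identityʳ 1#)) e))
      factor-vanishes (p ∷ ps) (p-prime ∷ ps-prime) e with fromℕ p ≟ 0#
      ... | yes p↦0 = p , p-prime , p↦0
      ... | no  p↦≢0 = factor-vanishes ps ps-prime (x≢0⇒xy≡0⇒y≡0 p↦≢0 (trans (sym (fromℕ-* p (product ps))) e))

  module Characteristic (r : ℕ) (r-prime : Prime r) (r↦0 : fromℕ r ≡ 0#) where
    instance
      r≢0 : NonZero r
      r≢0 = prime⇒nonZero r-prime

    fromℕ-multiple : ∀ m → fromℕ (m ℕ.* r) ≡ 0#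
    fromℕ-multiple m = trans (fromℕ-* m r) (trans (cong (fromℕ m *_) r↦0) (zeroʳ _))

    fromℤ-multiple : ∀ z → ℤ.+ r ℤ∣ᵤ.∣ z → fromℤ z ≡ 0#
    fromℤ-multiple z r∣z with ∣ᵤ⇒∣ {ℤ.+ r} {z} r∣z
    ... | ℤ∣.divides k refl = trans (fromℤ-* k (ℤ.+ r)) (trans (cong (fromℤ k *_) r↦0) (zeroʳ _))

    lincomb-≋ : ∀ {k} (v : Vector Carrier k) c d → c ≋[ r ] d → lincomb v c ≡ lincomb v d
    lincomb-≋ v c d c≋d = lincomb-cong v c d (λ j → x∙y⁻¹≈ε⇒x≈y _ _ (begin
      fromℤ (c j) + - fromℤ (d j)      ≡⟨ cong (fromℤ (c j) +_) (fromℤ-neg (d j)) ⟨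
      fromℤ (c j) + fromℤ (ℤ.- d j)    ≡⟨ fromℤ-+ (c j) (ℤ.- d j) ⟨
      fromℤ (c j ℤ.- d j)              ≡⟨ fromℤ-multiple (c j ℤ.- d j) (c≋d j) ⟩
      0#                               ∎))
      where open ≡-Reasoning

    private
      ¬∣⇒coprime : ∀ {n} → ¬ r ℕ∣.∣ n → Coprime r n
      ¬∣⇒coprime r∤n (d∣r , d∣n) with prime⇒irreducible r-prime d∣r
      ... | inj₁ d≡1 = d≡1
      ... | inj₂ refl = ⊥-elim (r∤n d∣n)

      fromℕ-invertible : ∀ n → ¬ r ℕ∣.∣ n → Σ ℤ λ u → fromℤ u * fromℕ n ≡ 1#
      fromℕ-invertible n r∤n with coprime-Bézout (¬∣⇒coprime r∤n)
      ... | Bézout.+- x y 1+yn≡xr = ℤ.- ℤ.+ y , (begin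
        fromℤ (ℤ.- ℤ.+ y) * fromℕ n      ≡⟨ cong (_* fromℕ n) (fromℤ-neg (ℤ.+ y)) ⟩
        - fromℕ y * fromℕ n              ≡⟨ -‿distribˡ-* (fromℕ y) (fromℕ n) ⟨
        - (fromℕ y * fromℕ n)            ≡⟨ cong -_ (inverseʳ-unique 1# _ 1+yn↦0) ⟩
        - (- 1#)                         ≡⟨ ⁻¹-involutive 1# ⟩
        1#                               ∎)
        where open ≡-Reasoning
              1+yn↦0 : 1# + fromℕ y * fromℕ n ≡ 0#
              1+yn↦0 = trans (cong (1# +_) (sym (fromℕ-* y n)))
                             (trans (cong fromℕ 1+yn≡xr) (fromℕ-multiple x))
      ... | Bézout.-+ x y 1+xr≡yn = ℤ.+ y , (begin
        fromℕ y * fromℕ n                ≡⟨ fromℕ-* y n ⟨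
        fromℕ (y ℕ.* n)                  ≡⟨ cong fromℕ 1+xr≡yn ⟨
        1# + fromℕ (x ℕ.* r)             ≡⟨ cong (1# +_) (fromℕ-multiple x) ⟩
        1# + 0#                          ≡⟨ +-identityʳ 1# ⟩
        1#                               ∎)
        where open ≡-Reasoning

    invertible : ∀ z → ¬ ℤ.+ r ℤ∣ᵤ.∣ z → Σ ℤ λ u → fromℤ u * fromℤ z ≡ 1#
    invertible (ℤ.+ n)  r∤z = fromℕ-invertible n r∤z
    invertible -[1+ n ] r∤z with fromℕ-invertible (suc n) r∤z
    ... | u , u*n≡1 = ℤ.- u , trans (cong (_* fromℤ -[1+ n ]) (fromℤ-neg u))
      (trans (solve 2 (λ u n → (:- u) :* (:- n) := u :* n) refl (fromℤ u) (fromℕ (suc n))) u*n≡1)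

    independent-∷ : ∀ {k} (v : Vector Carrier k) a → Independent r v → ¬ Spans v a → Independent r (a ∷ᶠ v)
    independent-∷ v a indep a∉span c e with r ℕ∣.∣? ℤ.∣ c Fin.zero ∣
    ... | yes r∣c₀ = λ { Fin.zero → r∣c₀ ; (Fin.suc j) → indep (tail c) rest≡0 j }
      where
        open ≡-Reasoning
        rest≡0 : lincomb v (tail c) ≡ 0#
        rest≡0 = begin
          lincomb v (tail c)                         ≡⟨ +-identityˡ _ ⟨
          0# + lincomb v (tail c)                    ≡⟨ cong (_+ lincomb v (tail c)) (zeroˡ a) ⟨
          0# * a + lincomb v (tail c)                ≡⟨ cong (λ x → x * a + lincomb v (tail c)) (fromℤ-multiple (c Fin.zero) r∣c₀) ⟨
          fromℤ (c Fin.zero) * a + lincomb v (tail c) ≡⟨ e ⟩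
          0#                                         ∎
    ... | no r∤c₀ with invertible (c Fin.zero) r∤c₀
    ...   | u , u*c₀≡1 = ⊥-elim (a∉span ((λ j → ℤ.- u ℤ.* tail c j) , (begin
      lincomb v (λ j → ℤ.- u ℤ.* tail c j)  ≡⟨ lincomb-* v (ℤ.- u) (tail c) ⟩
      fromℤ (ℤ.- u) * lincomb v (tail c)    ≡⟨ cong₂ _*_ (fromℤ-neg u) (inverseʳ-unique _ _ e) ⟩
      - fromℤ u * - (fromℤ c₀ * a)          ≡⟨ solve 3 (λ u c a → (:- u) :* (:- (c :* a)) := (u :* c) :* a) refl (fromℤ u) (fromℤ c₀) a ⟩
      (fromℤ u * fromℤ c₀) * a              ≡⟨ cong (_* a) u*c₀≡1 ⟩
      1# * a                                ≡⟨ *-identityˡ a ⟩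
      a                                     ∎)))
      where open ≡-Reasoning
            c₀ : ℤ
            c₀ = c Fin.zero

    -- Coefficient vectors reduced modulo r, packed into one index; this makes spanning
    -- decidable and lets us count the span.
    digits : ∀ {k} → (Fin k → ℤ) → Fin (r ℕ.^ k)
    digits c = funToFin (λ j → fromℕ< (n%ℕd<d (c j) r))

    undigits : ∀ {k} → Fin (r ℕ.^ k) → Fin k → ℤ
    undigits n j = ℤ.+ toℕ (finToFun n j)

    fromℤ-%ℕ : ∀ z → fromℤ (ℤ.+ (z %ℕ r)) ≡ fromℤ z
    fromℤ-%ℕ z = sym (begin
      fromℤ z                                       ≡⟨ cong fromℤ (a≡a%ℕn+[a/ℕn]*n z r) ⟩
      fromℤ (ℤ.+ (z %ℕ r) ℤ.+ (z /ℕ r) ℤ.* ℤ.+ r)  ≡⟨ fromℤ-+ (ℤ.+ (z %ℕ r)) ((z /ℕ r) ℤ.* ℤ.+ r) ⟩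
      fromℤ (ℤ.+ (z %ℕ r)) + fromℤ ((z /ℕ r) ℤ.* ℤ.+ r)
        ≡⟨ cong (fromℤ (ℤ.+ (z %ℕ r)) +_) (fromℤ-multiple ((z /ℕ r) ℤ.* ℤ.+ r) (ℤ∣ᵤ.divides (ℤ.∣ z /ℕ r ∣) (ℤₚ.abs-* (z /ℕ r) (ℤ.+ r)))) ⟩
      fromℤ (ℤ.+ (z %ℕ r)) + 0#                     ≡⟨ +-identityʳ _ ⟩
      fromℤ (ℤ.+ (z %ℕ r))                          ∎)
      where open ≡-Reasoning

    lincomb-undigits-digits : ∀ {k} (v : Vector Carrier k) c → lincomb v (undigits (digits c)) ≡ lincomb v c
    lincomb-undigits-digits v c = lincomb-cong v (undigits (digits c)) c λ j → begin
      fromℤ (ℤ.+ toℕ (finToFun (digits c) j))       ≡⟨ cong (λ i → fromℕ (toℕ i)) (Finₚ.finToFun-funToFin (λ j → fromℕ< (n%ℕd<d (c j) r)) j) ⟩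
      fromℕ (toℕ (fromℕ< (n%ℕd<d (c j) r)))          ≡⟨ cong fromℕ (Finₚ.toℕ-fromℕ< (n%ℕd<d (c j) r)) ⟩
      fromℤ (ℤ.+ (c j %ℕ r))                        ≡⟨ fromℤ-%ℕ (c j) ⟩
      fromℤ (c j)                                   ∎
      where open ≡-Reasoning

    private
      below-multiple : ∀ {d} → r ℕ∣.∣ d → d ℕ.< r → d ≡ 0
      below-multiple {zero}  _   _   = refl
      below-multiple {suc d} r∣d d<r = ⊥-elim (ℕₚ.<⇒≱ d<r (ℕ∣.∣⇒≤ r∣d))

      digit-injective : ∀ {a b} → a ℕ.< r → b ℕ.< r → ℤ.+ r ℤ∣ᵤ.∣ (ℤ.+ a ℤ.- ℤ.+ b) → a ≡ b
      digit-injective {a} {b} a<r b<r r∣a-b = ℤₚ.+-injective (ℤₚ.i-j≡0⇒i≡j _ _ (ℤₚ.∣i∣≡0⇒i≡0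
        (below-multiple r∣a-b (subst (ℕ._< r) (cong ℤ.∣_∣ (sym (ℤₚ.m-n≡m⊖n a b)))
          (ℕₚ.≤-<-trans (ℤₚ.∣m⊝n∣≤m⊔n a b) (ℕₚ.⊔-lub a<r b<r))))))

      funToFin-cong : ∀ {m n} {f g : Fin m → Fin n} → (∀ j → f j ≡ g j) → funToFin f ≡ funToFin g
      funToFin-cong {zero}  f≗g = refl
      funToFin-cong {suc m} f≗g = cong₂ combine (f≗g Fin.zero) (funToFin-cong (λ j → f≗g (Fin.suc j)))

    undigits-injective : ∀ {k} {n n' : Fin (r ℕ.^ k)} → undigits {k} n ≋[ r ] undigits n' → n ≡ n'
    undigits-injective {k} {n} {n'} n≋n' = begin
      n                   ≡⟨ Finₚ.funToFin-finToFin {k} {r} n ⟨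
      funToFin (digit n)  ≡⟨ funToFin-cong (λ j → Finₚ.toℕ-injective
                               (digit-injective (Finₚ.toℕ<n (digit n j)) (Finₚ.toℕ<n (digit n' j)) (n≋n' j))) ⟩
      funToFin (digit n') ≡⟨ Finₚ.funToFin-finToFin {k} {r} n' ⟩
      n'                  ∎
      where open ≡-Reasoning
            digit : Fin (r ℕ.^ k) → Fin k → Fin r
            digit = finToFun

    spans? : ∀ {k} (v : Vector Carrier k) x → Dec (Spans v x)
    spans? v x with Finₚ.any? (λ n → lincomb v (undigits n) ≟ x)
    ... | yes (n , e) = yes (undigits n , e)
    ... | no ¬digits  = no (λ (c , e) → ¬digits (digits c , trans (lincomb-undigits-digits v c) e))

    independent⇒r^k≤q : ∀ {k} (v : Vector Carrier k) → Independent r v → r ℕ.^ k ℕ.≤ q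
    independent⇒r^k≤q v indep = Finₚ.injective⇒≤ {f = λ n → Enum.to (lincomb v (undigits n))}
      (λ {n} {n'} e → undigits-injective (lincomb-injective v indep (undigits n) (undigits n') (Enum-to-injective e)))

    spanning⇒q≤r^k : ∀ {k} (v : Vector Carrier k) → (∀ x → Spans v x) → q ℕ.≤ r ℕ.^ k
    spanning⇒q≤r^k v spans = Finₚ.injective⇒≤ {f = λ i → digits (coefficients i)} λ {i} {i'} e →
      Enum-from-injective (begin
        Enum.from i                                   ≡⟨ proj₂ (spans (Enum.from i)) ⟨
        lincomb v (coefficients i)                    ≡⟨ lincomb-undigits-digits v (coefficients i) ⟨
        lincomb v (undigits (digits (coefficients i))) ≡⟨ cong (λ n → lincomb v (undigits n)) e ⟩
        lincomb v (undigits (digits (coefficients i'))) ≡⟨ lincomb-undigits-digits v (coefficients i') ⟩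
        lincomb v (coefficients i')                   ≡⟨ proj₂ (spans (Enum.from i')) ⟩
        Enum.from i'                                  ∎)
      where open ≡-Reasoning
            coefficients : Fin q → Fin _ → ℤ
            coefficients i = proj₁ (spans (Enum.from i))

    private
      instance
        r-nonTrivial : ℕ.NonTrivial r
        r-nonTrivial = prime⇒nonTrivial r-prime

      k<r^k : ∀ k → k ℕ.< r ℕ.^ k
      k<r^k zero    = ℕₚ.n<1+n 0
      k<r^k (suc k) = ℕₚ.≤-<-trans (k<r^k k) (ℕₚ.^-monoʳ-< r (ℕ.nonTrivial⇒n>1 r) (ℕₚ.n<1+n k))

      -- Greedy extension of an independent family; the fuel never runs out because an
      -- independent family of size k has k < r^k ≤ q.
      grow : ∀ fuel {k} (v : Vector Carrier k) → Independent r v → q ℕ.< fuel ℕ.+ k →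
             Σ ℕ λ m → r ℕ.^ m ≡ q × Basis r m
      grow zero    {k} v indep q<k =
        ⊥-elim (ℕₚ.<-irrefl refl (ℕₚ.<-≤-trans q<k (ℕₚ.<⇒≤ (ℕₚ.<-≤-trans (k<r^k k) (independent⇒r^k≤q v indep)))))
      grow (suc fuel) {k} v indep q<fuel+k with Finₚ.all? (λ i → spans? v (Enum.from i))
      ... | yes spansAll = k , ℕₚ.≤-antisym (independent⇒r^k≤q v indep) (spanning⇒q≤r^k v spans)
                             , record { vector = v ; independent = indep ; spanning = spans }
        where spans : ∀ x → Spans v x
              spans x = subst (Spans v) (Enum.strictlyInverseʳ x) (spansAll (Enum.to x))
      ... | no ¬spansAll with Finₚ.¬∀⟶∃¬ q _ (λ i → spans? v (Enum.from i)) ¬spansAll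
      ...   | i , i∉span = grow fuel (Enum.from i ∷ᶠ v) (independent-∷ v (Enum.from i) indep i∉span)
                                (subst (q ℕ.<_) (sym (ℕₚ.+-suc fuel k)) q<fuel+k)

    basis : Σ ℕ λ k → r ℕ.^ k ≡ q × Basis r k
    basis = grow (suc q) (λ ()) (λ _ _ ()) (subst (q ℕ.<_) (sym (ℕₚ.+-identityʳ (suc q))) (ℕₚ.n<1+n q))

  primeBasis : ∀ p α → Prime p → q ≡ p ℕ.^ α → fromℕ p ≡ 0# × Basis p α
  primeBasis p zero    p-prime q≡1 = ⊥-elim (q≢1 q≡1)
  primeBasis p (suc a) p-prime q≡p^α with characteristic
  ... | r , r-prime , r↦0 with Characteristic.basis r r-prime r↦0
  ...   | k , r^k≡q , B with prime-power-injective {a = a} {k} p-prime r-prime (trans (sym q≡p^α) (sym r^k≡q))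
  ...     | refl , refl = r↦0 , B

  module BasisCoordinates {p α} (p-prime : Prime p) (p↦0 : fromℕ p ≡ 0#) (B : Basis p α) where
    open Basis B
    open Characteristic p p-prime p↦0 using (lincomb-≋)

    coordinates : Carrier → Fin α → ℤ
    coordinates x = proj₁ (spanning x)

    lincomb-coordinates : ∀ x → lincomb vector (coordinates x) ≡ x
    lincomb-coordinates x = proj₂ (spanning x)

    coordinates-≋ : ∀ {x y} → x ≡ y → coordinates x ≋[ p ] coordinates y
    coordinates-≋ {x} {y} x≡y = lincomb-injective vector independent (coordinates x) (coordinates y)
      (trans (lincomb-coordinates x) (trans x≡y (sym (lincomb-coordinates y))))

    coordinates-injective : ∀ {x y} → coordinates x ≋[ p ] coordinates y → x ≡ y
    coordinates-injective {x} {y} x≋y = trans (sym (lincomb-coordinates x))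
      (trans (lincomb-≋ vector (coordinates x) (coordinates y) x≋y) (lincomb-coordinates y))

    coordinates-lincomb : ∀ {x} c → x ≡ lincomb vector c → coordinates x ≋[ p ] c
    coordinates-lincomb {x} c x≡ = lincomb-injective vector independent (coordinates x) c (trans (lincomb-coordinates x) x≡)

    coordinates-twist : ∀ s x y {z} → z ≡ x + ±1 s * y →
                        coordinates z ≋[ p ] (λ j → coordinates x j ℤ.+ twist s (coordinates y j))
    coordinates-twist s x y {z} z≡ = lincomb-injective vector independent
      (coordinates z) (λ j → coordinates x j ℤ.+ twist s (coordinates y j)) (begin
      lincomb vector (coordinates z)                                    ≡⟨ lincomb-coordinates z ⟩
      z                                                                 ≡⟨ z≡ ⟩
      x + ±1 s * y                                                      ≡⟨ cong₂ _+_ (lincomb-coordinates x) (lincomb-twist s) ⟨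
      lincomb vector (coordinates x) + lincomb vector (λ j → twist s (coordinates y j))
                                                                        ≡⟨ lincomb-+ vector (coordinates x) (λ j → twist s (coordinates y j)) ⟨
      lincomb vector (λ j → coordinates x j ℤ.+ twist s (coordinates y j)) ∎)
      where
        open ≡-Reasoning
        lincomb-twist : ∀ s → lincomb vector (λ j → twist s (coordinates y j)) ≡ ±1 s * y
        lincomb-twist false = trans (lincomb-coordinates y) (sym (*-identityˡ y))
        lincomb-twist true  = trans (lincomb-neg vector (coordinates y))
          (trans (cong -_ (lincomb-coordinates y)) (sym (-1*x≈-x y)))

-- A primitive fourth root of unity

module Generator {q : ℕ} (F : FiniteField q) (ω : FiniteField.Carrier F)
                 (ω-generator : FieldOps.IsGenerator F ω) where
  open FieldLemmas F

  ω≢0 : ω ≢ 0#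
  ω≢0 = proj₁ ω-generator

  log : ∀ x → x ≢ 0# → ℕ
  log x x≢0 = proj₁ (proj₂ ω-generator x x≢0)

  ω^log : ∀ x (x≢0 : x ≢ 0#) → ω ^ log x x≢0 ≡ x
  ω^log x x≢0 = proj₂ (proj₂ ω-generator x x≢0)

  -- A nonzero x is determined by its discrete logarithm modulo m + 1.
  order-bound : ∀ m → ω ^ suc m ≡ 1# → q ℕ.≤ suc (suc m)
  order-bound m ω^[1+m]≡1 = Finₚ.injective⇒≤ {f = index} index-injective
    where
      reducedLog : ∀ x → x ≢ 0# → Fin (suc m)
      reducedLog x x≢0 = fromℕ< (m%n<n (log x x≢0) (suc m))

      ω^reducedLog : ∀ x (x≢0 : x ≢ 0#) → ω ^ toℕ (reducedLog x x≢0) ≡ x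
      ω^reducedLog x x≢0 = trans (cong (ω ^_) (Finₚ.toℕ-fromℕ< (m%n<n (log x x≢0) (suc m))))
                                 (trans (^-%-periodic ω m (log x x≢0) ω^[1+m]≡1) (ω^log x x≢0))

      index′ : ∀ x → Dec (x ≡ 0#) → Fin (suc (suc m))
      index′ x (yes _)   = Fin.zero
      index′ x (no x≢0)  = Fin.suc (reducedLog x x≢0)

      index : Fin q → Fin (suc (suc m))
      index i = index′ (Enum.from i) (Enum.from i ≟ 0#)

      index-injective : ∀ {i j} → index i ≡ index j → i ≡ j
      index-injective {i} {j} e with Enum.from i ≟ 0# | Enum.from j ≟ 0#
      ... | yes x≡0 | yes y≡0 = Enum-from-injective (trans x≡0 (sym y≡0))
      ... | yes _   | no _    = ⊥-elim (Finₚ.0≢1+n e)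
      ... | no _    | yes _   = ⊥-elim (Finₚ.0≢1+n (sym e))
      ... | no x≢0  | no y≢0  = Enum-from-injective (trans (sym (ω^reducedLog _ x≢0))
          (trans (cong (λ k → ω ^ toℕ k) (Finₚ.suc-injective e)) (ω^reducedLog _ y≢0)))

  private
    powerIndex : Fin (suc q) → Fin q
    powerIndex Fin.zero    = Enum.to 0#
    powerIndex (Fin.suc i) = Enum.to (ω ^ toℕ i)

  -- Pigeonhole on 0, ω⁰, …, ω^(q−1); a collision cannot involve 0.
  power-cycle : Σ ℕ λ d → 0 ℕ.< d × d ℕ.< q × ω ^ d ≡ 1#
  power-cycle with Finₚ.pigeonhole (ℕₚ.n<1+n q) powerIndex
  ... | Fin.zero  , Fin.suc j , _   , e = ⊥-elim (^-nonZero ω (toℕ j) ω≢0 (sym (Enum-to-injective e)))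
  ... | Fin.suc i , Fin.suc j , i<j , e =
    d , ℕₚ.m<n⇒0<n∸m i′<j′ , ℕₚ.≤-<-trans (ℕₚ.m∸n≤m (toℕ j) (toℕ i)) (Finₚ.toℕ<n j) ,
    *-cancelˡ (^-nonZero ω (toℕ i) ω≢0) (begin
      ω ^ toℕ i * ω ^ d        ≡⟨ ^-+ ω (toℕ i) d ⟨
      ω ^ (toℕ i ℕ.+ d)        ≡⟨ cong (ω ^_) (ℕₚ.m+[n∸m]≡n (ℕₚ.<⇒≤ i′<j′)) ⟩
      ω ^ toℕ j                ≡⟨ Enum-to-injective e ⟨
      ω ^ toℕ i                ≡⟨ *-identityʳ _ ⟨
      ω ^ toℕ i * 1#           ∎)
    where open ≡-Reasoning
          d : ℕ
          d = toℕ j ℕ.∸ toℕ i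
          i′<j′ : toℕ i ℕ.< toℕ j
          i′<j′ = ℕₚ.≤-pred i<j

  ω^[q∸1]≡1 : ω ^ (q ℕ.∸ 1) ≡ 1#
  ω^[q∸1]≡1 with power-cycle
  ... | suc m , _ , d<q , ω^d≡1 =
    subst (λ n → ω ^ n ≡ 1#) (cong (ℕ._∸ 1) (ℕₚ.≤-antisym d<q (order-bound m ω^d≡1))) ω^d≡1

  ω^m≢1 : ∀ m → 0 ℕ.< m → suc m ℕ.< q → ω ^ m ≢ 1#
  ω^m≢1 (suc m) _ 1+m<q ω^m≡1 = ℕₚ.<⇒≱ 1+m<q (order-bound m ω^m≡1)

module FourthRoot {q : ℕ} (F : FiniteField q) (ω : FiniteField.Carrier F)
                  (ω-generator : FieldOps.IsGenerator F ω) (q%4≡1 : q % 4 ≡ 1) where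
  open FieldLemmas F
  open Generator F ω ω-generator

  t : ℕ
  t = (q ℕ.∸ 1) / 4

  i : Carrier
  i = iOf ω

  q≡1+t*4 : q ≡ suc (t ℕ.* 4)
  q≡1+t*4 = trans q≡1+[q/4]*4 (cong (λ s → suc (s ℕ.* 4)) (sym t≡q/4))
    where q≡1+[q/4]*4 : q ≡ suc (q / 4 ℕ.* 4)
          q≡1+[q/4]*4 = trans (m≡m%n+[m/n]*n q 4) (cong (ℕ._+ q / 4 ℕ.* 4) q%4≡1)
          t≡q/4 : t ≡ q / 4
          t≡q/4 = trans (cong (λ n → (n ℕ.∸ 1) / 4) q≡1+[q/4]*4) (m*n/n≡m (q / 4) 4)

  private
    instance
      t≢0 : ℕ.NonZero t
      t≢0 = ℕ.≢-nonZero λ t≡0 → q≢1 (trans q≡1+t*4 (cong (λ s → suc (s ℕ.* 4)) t≡0))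

  i*i≡ω^[2t] : i * i ≡ ω ^ (2 ℕ.* t)
  i*i≡ω^[2t] = trans (cong (i *_) (sym (*-identityʳ i))) (sym (^-* ω 2 t))

  i*i≢1 : i * i ≢ 1#
  i*i≢1 i²≡1 = ω^m≢1 (2 ℕ.* t) (ℕₚ.*-monoʳ-< 2 (ℕ.>-nonZero⁻¹ t))
    (subst (suc (2 ℕ.* t) ℕ.<_) (sym (trans q≡1+t*4 (cong suc (ℕₚ.*-comm t 4))))
           (ℕ.s≤s (ℕₚ.*-monoˡ-< t (ℕ.s≤s (ℕ.s≤s (ℕ.s≤s (ℕ.z≤n {1})))))))
    (trans (sym i*i≡ω^[2t]) i²≡1)

  i*i≡-1 : i * i ≡ - 1#
  i*i≡-1 with x*x≡y*y⇒x≡±y (i * i) 1# (trans i⁴≡1 (sym (*-identityˡ 1#)))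
    where
      i⁴≡1 : (i * i) * (i * i) ≡ 1#
      i⁴≡1 = begin
        (i * i) * (i * i)   ≡⟨ solve 1 (λ i → (i :* i) :* (i :* i) := i :* (i :* (i :* i))) refl i ⟩
        i * (i * (i * i))   ≡⟨ cong (λ z → i * (i * (i * z))) (*-identityʳ i) ⟨
        i ^ 4               ≡⟨ ^-* ω 4 t ⟨
        ω ^ (4 ℕ.* t)       ≡⟨ cong (ω ^_) (trans (ℕₚ.*-comm 4 t) (cong ℕ.pred (sym q≡1+t*4))) ⟩
        ω ^ (q ℕ.∸ 1)       ≡⟨ ω^[q∸1]≡1 ⟩
        1#                  ∎
        where open ≡-Reasoning
  ... | inj₁ i²≡1  = ⊥-elim (i*i≢1 i²≡1)
  ... | inj₂ i²≡-1 = i²≡-1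

  1≢-1 : 1# ≢ - 1#
  1≢-1 1≡-1 = i*i≢1 (trans i*i≡-1 (sym 1≡-1))

  i^k*i^k≡±1 : ∀ k → i ^ k * i ^ k ≡ 1# ⊎ i ^ k * i ^ k ≡ - 1#
  i^k*i^k≡±1 k = subst (λ x → x ≡ 1# ⊎ x ≡ - 1#) (^-distribʳ-* i i k)
                       (subst (λ x → x ^ k ≡ 1# ⊎ x ^ k ≡ - 1#) (sym i*i≡-1) ([-1]^k≡±1 k))
    where
      [-1]^k≡±1 : ∀ k → (- 1#) ^ k ≡ 1# ⊎ (- 1#) ^ k ≡ - 1#
      [-1]^k≡±1 zero    = inj₁ refl
      [-1]^k≡±1 (suc k) with [-1]^k≡±1 k
      ... | inj₁ e = inj₂ (trans (cong (- 1# *_) e) (*-identityʳ _))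
      ... | inj₂ e = inj₁ (trans (cong (- 1# *_) e) (trans (solve 1 (λ o → (:- o) :* (:- o) := o :* o) refl 1#) (*-identityʳ 1#)))

-- 2 × 2 matrices and change of basis

module Matrices {q : ℕ} (F : FiniteField q) where
  open FieldLemmas F

  mat-cong : ∀ {a b c d a' b' c' d'} → a ≡ a' → b ≡ b' → c ≡ c' → d ≡ d' → mat a b c d ≡ mat a' b' c' d'
  mat-cong refl refl refl refl = refl

  adj : Mat → Mat
  adj (mat a b c d) = mat d (- b) (- c) a

  scaleM : Carrier → Mat → Mat
  scaleM k (mat a b c d) = mat (k * a) (k * b) (k * c) (k * d)

  column₁ : Mat → Vec2
  column₁ M = (Mat.a M , Mat.c M)

  ·-assoc : ∀ M N K → (M · N) · K ≡ M · (N · K)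
  ·-assoc (mat a b c d) (mat a' b' c' d') (mat a'' b'' c'' d'') =
    mat-cong (entry a b a'' c'') (entry a b b'' d'') (entry c d a'' c'') (entry c d b'' d'')
    where
      entry : ∀ x y z w → (x * a' + y * c') * z + (x * b' + y * d') * w ≡ x * (a' * z + b' * w) + y * (c' * z + d' * w)
      entry = λ x y z w → solve 8 (λ x y z w a' b' c' d' →
        (x :* a' :+ y :* c') :* z :+ (x :* b' :+ y :* d') :* w := x :* (a' :* z :+ b' :* w) :+ y :* (c' :* z :+ d' :* w))
        refl x y z w a' b' c' d'

  adj-· : ∀ M N → adj M · (M · N) ≡ scaleM (det M) N
  adj-· (mat a b c d) (mat x y z w) =
    mat-cong (entryˡ x z) (entryˡ y w) (entryʳ x z) (entryʳ y w)
    where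
      entryˡ : ∀ x z → d * (a * x + b * z) + - b * (c * x + d * z) ≡ (a * d + - (b * c)) * x
      entryˡ x z = solve 6 (λ a b c d x z → d :* (a :* x :+ b :* z) :+ (:- b) :* (c :* x :+ d :* z) := (a :* d :+ :- (b :* c)) :* x) refl a b c d x z
      entryʳ : ∀ x z → - c * (a * x + b * z) + a * (c * x + d * z) ≡ (a * d + - (b * c)) * z
      entryʳ x z = solve 6 (λ a b c d x z → (:- c) :* (a :* x :+ b :* z) :+ a :* (c :* x :+ d :* z) := (a :* d :+ :- (b :* c)) :* z) refl a b c d x z

  ·-adj : ∀ M N → (N · M) · adj M ≡ scaleM (det M) N
  ·-adj (mat a b c d) (mat x y z w) =
    mat-cong (entryˡ x y) (entryʳ x y) (entryˡ z w) (entryʳ z w)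
    where
      entryˡ : ∀ x y → (x * a + y * c) * d + (x * b + y * d) * - c ≡ (a * d + - (b * c)) * x
      entryˡ x y = solve 6 (λ a b c d x y → (x :* a :+ y :* c) :* d :+ (x :* b :+ y :* d) :* (:- c) := (a :* d :+ :- (b :* c)) :* x) refl a b c d x y
      entryʳ : ∀ x y → (x * a + y * c) * - b + (x * b + y * d) * a ≡ (a * d + - (b * c)) * y
      entryʳ x y = solve 6 (λ a b c d x y → (x :* a :+ y :* c) :* (:- b) :+ (x :* b :+ y :* d) :* a := (a :* d :+ :- (b :* c)) :* y) refl a b c d x y

  adj-involutive : ∀ M → adj (adj M) ≡ M
  adj-involutive (mat a b c d) = mat-cong refl (⁻¹-involutive b) (⁻¹-involutive c) refl

  det-adj : ∀ M → det (adj M) ≡ det M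
  det-adj (mat a b c d) = solve 4 (λ a b c d → d :* a :+ :- ((:- b) :* (:- c)) := a :* d :+ :- (b :* c)) refl a b c d

  det-· : ∀ M N → det (M · N) ≡ det M * det N
  det-· (mat a b c d) (mat x y z w) = solve 8 (λ a b c d x y z w →
    (a :* x :+ b :* z) :* (c :* y :+ d :* w) :+ :- ((a :* y :+ b :* w) :* (c :* x :+ d :* z))
      := (a :* d :+ :- (b :* c)) :* (x :* w :+ :- (y :* z))) refl a b c d x y z w

  scaleM-1 : ∀ M → scaleM 1# M ≡ M
  scaleM-1 (mat a b c d) = mat-cong (*-identityˡ a) (*-identityˡ b) (*-identityˡ c) (*-identityˡ d)

  scaleM-[-1] : ∀ M → scaleM (- 1#) M ≡ negM M
  scaleM-[-1] (mat a b c d) = mat-cong (-1*x≈-x a) (-1*x≈-x b) (-1*x≈-x c) (-1*x≈-x d)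

  ·-negMʳ : ∀ M N → M · negM N ≡ negM (M · N)
  ·-negMʳ (mat a b c d) (mat x y z w) = mat-cong (entry a b x z) (entry a b y w) (entry c d x z) (entry c d y w)
    where entry : ∀ a b x z → a * - x + b * - z ≡ - (a * x + b * z)
          entry = λ a b x z → solve 4 (λ a b x z → a :* (:- x) :+ b :* (:- z) := :- (a :* x :+ b :* z)) refl a b x z

  negM-·ˡ : ∀ M N → negM M · N ≡ negM (M · N)
  negM-·ˡ (mat a b c d) (mat x y z w) = mat-cong (entry a b x z) (entry a b y w) (entry c d x z) (entry c d y w)
    where entry : ∀ a b x z → - a * x + - b * z ≡ - (a * x + b * z)
          entry = λ a b x z → solve 4 (λ a b x z → (:- a) :* x :+ (:- b) :* z := :- (a :* x :+ b :* z)) refl a b x z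

  act-adj : ∀ M w → act (adj M) (act M w) ≡ scale (det M) w
  act-adj (mat a b c d) (x , z) = cong₂ _,_
    (solve 6 (λ a b c d x z → d :* (a :* x :+ b :* z) :+ (:- b) :* (c :* x :+ d :* z) := (a :* d :+ :- (b :* c)) :* x) refl a b c d x z)
    (solve 6 (λ a b c d x z → (:- c) :* (a :* x :+ b :* z) :+ a :* (c :* x :+ d :* z) := (a :* d :+ :- (b :* c)) :* z) refl a b c d x z)

  act-column₁ : ∀ M x → act M (x , 0#) ≡ scale x (column₁ M)
  act-column₁ (mat a b c d) x = cong₂ _,_ (entry a b) (entry c d)
    where entry : ∀ a b → a * x + b * 0# ≡ x * a
          entry a b = solve 3 (λ a b x → a :* x :+ b :* con (ℤ.+ 0) := x :* a) refl a b x

  scale-1 : ∀ w → scale 1# w ≡ w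
  scale-1 (x , z) = cong₂ _,_ (*-identityˡ x) (*-identityˡ z)

  unimodularCompletion : ∀ π → NonZeroVec π → Σ Mat λ P → column₁ P ≡ π × det P ≡ 1#
  unimodularCompletion (x , y) π≢0 with x ≟ 0#
  ... | no x≢0 = mat x 0# y x⁻¹ , refl , (begin
    x * x⁻¹ + - (0# * y)     ≡⟨ cong (λ z → x * x⁻¹ + - z) (zeroˡ y) ⟩
    x * x⁻¹ + - 0#           ≡⟨ cong (x * x⁻¹ +_) ε⁻¹≈ε ⟩
    x * x⁻¹ + 0#             ≡⟨ +-identityʳ _ ⟩
    x * x⁻¹                  ≡⟨ *-inverseʳ x x≢0 ⟩
    1#                       ∎)
    where open ≡-Reasoning
          x⁻¹ : Carrier
          x⁻¹ = (x ⁻¹) x≢0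
  ... | yes x≡0 = mat x (- y⁻¹) y 0# , refl , (begin
    x * 0# + - (- y⁻¹ * y)   ≡⟨ solve 3 (λ x y y' → x :* con (ℤ.+ 0) :+ :- ((:- y') :* y) := y :* y') refl x y y⁻¹ ⟩
    y * y⁻¹                  ≡⟨ *-inverseʳ y y≢0 ⟩
    1#                       ∎)
    where open ≡-Reasoning
          y≢0 : y ≢ 0#
          y≢0 y≡0 = π≢0 (x≡0 , y≡0)
          y⁻¹ : Carrier
          y⁻¹ = (y ⁻¹) y≢0

  module Conjugation (P : Mat) (det-P≡1 : det P ≡ 1#) where
    private
      Q : Mat
      Q = adj P

      det-Q≡1 : det Q ≡ 1#
      det-Q≡1 = trans (det-adj P) det-P≡1

      Q·P· : ∀ N → Q · (P · N) ≡ N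
      Q·P· N = trans (adj-· P N) (trans (cong (λ k → scaleM k N) det-P≡1) (scaleM-1 N))

      P·Q· : ∀ N → P · (Q · N) ≡ N
      P·Q· N = trans (cong (_· (Q · N)) (sym (adj-involutive P)))
                     (trans (adj-· Q N) (trans (cong (λ k → scaleM k N) det-Q≡1) (scaleM-1 N)))

      ·P·Q : ∀ N → (N · P) · Q ≡ N
      ·P·Q N = trans (·-adj P N) (trans (cong (λ k → scaleM k N) det-P≡1) (scaleM-1 N))

      ·Q·P : ∀ N → (N · Q) · P ≡ N
      ·Q·P N = trans (cong ((N · Q) ·_) (sym (adj-involutive P)))
                     (trans (·-adj Q N) (trans (cong (λ k → scaleM k N) det-Q≡1) (scaleM-1 N)))

    conj : Mat → Mat
    conj g = Q · (g · P)

    unconj : Mat → Mat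
    unconj M = P · (M · Q)

    conj-· : ∀ g h → conj (g · h) ≡ conj g · conj h
    conj-· g h = sym (begin
      (Q · (g · P)) · (Q · (h · P))    ≡⟨ ·-assoc Q (g · P) (Q · (h · P)) ⟩
      Q · ((g · P) · (Q · (h · P)))    ≡⟨ cong (Q ·_) (·-assoc g P (Q · (h · P))) ⟩
      Q · (g · (P · (Q · (h · P))))    ≡⟨ cong (λ N → Q · (g · N)) (P·Q· (h · P)) ⟩
      Q · (g · (h · P))                ≡⟨ cong (Q ·_) (·-assoc g h P) ⟨
      Q · ((g · h) · P)                ∎)
      where open ≡-Reasoning

    unconj-conj : ∀ g → unconj (conj g) ≡ g
    unconj-conj g = begin
      P · ((Q · (g · P)) · Q)          ≡⟨ cong (P ·_) (·-assoc Q (g · P) Q) ⟩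
      P · (Q · ((g · P) · Q))          ≡⟨ P·Q· ((g · P) · Q) ⟩
      (g · P) · Q                      ≡⟨ ·P·Q g ⟩
      g                                ∎
      where open ≡-Reasoning

    conj-unconj : ∀ M → conj (unconj M) ≡ M
    conj-unconj M = begin
      Q · ((P · (M · Q)) · P)          ≡⟨ cong (Q ·_) (·-assoc P (M · Q) P) ⟩
      Q · (P · ((M · Q) · P))          ≡⟨ Q·P· ((M · Q) · P) ⟩
      (M · Q) · P                      ≡⟨ ·Q·P M ⟩
      M                                ∎
      where open ≡-Reasoning

    conj-injective : ∀ {g h} → conj g ≡ conj h → g ≡ h
    conj-injective {g} {h} e = trans (sym (unconj-conj g)) (trans (cong unconj e) (unconj-conj h))

    conj-negM : ∀ g → conj (negM g) ≡ negM (conj g)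
    conj-negM g = trans (cong (Q ·_) (negM-·ˡ g P)) (·-negMʳ Q (g · P))

    det-conj : ∀ g → det (conj g) ≡ det g
    det-conj g = begin
      det (Q · (g · P))                ≡⟨ det-· Q (g · P) ⟩
      det Q * det (g · P)              ≡⟨ cong₂ _*_ det-Q≡1 (det-· g P) ⟩
      1# * (det g * det P)             ≡⟨ cong (λ k → 1# * (det g * k)) det-P≡1 ⟩
      1# * (det g * 1#)                ≡⟨ trans (*-identityˡ _) (*-identityʳ _) ⟩
      det g                            ∎
      where open ≡-Reasoning

    act-conj : ∀ g → act P (column₁ (conj g)) ≡ act g (column₁ P)
    act-conj g = cong column₁ (P·Q· (g · P))

    act-P-injective : ∀ {w w'} → act P w ≡ act P w' → w ≡ w'
    act-P-injective {w} {w'} e = begin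
      w                    ≡⟨ scale-1 w ⟨
      scale 1# w           ≡⟨ cong (λ k → scale k w) det-P≡1 ⟨
      scale (det P) w      ≡⟨ act-adj P w ⟨
      act Q (act P w)      ≡⟨ cong (act Q) e ⟩
      act Q (act P w')     ≡⟨ act-adj P w' ⟩
      scale (det P) w'     ≡⟨ cong (λ k → scale k w') det-P≡1 ⟩
      scale 1# w'          ≡⟨ scale-1 w' ⟩
      w'                   ∎
      where open ≡-Reasoning

-- The stabiliser of [π]

module Stabiliser {q : ℕ} (F : FiniteField q) (ω : FiniteField.Carrier F)
                  (ω-generator : FieldOps.IsGenerator F ω) (q%4≡1 : q % 4 ≡ 1)
                  {p α : ℕ} (p-prime : Prime p) (p↦0 : FieldLemmas.fromℕ F p ≡ FiniteField.0# F)
                  (B : PrimeSubfield.Basis F p α)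
                  (π : FieldOps.Vec2 F) (π≢0 : FieldOps.NonZeroVec F π) where
  open FieldLemmas F
  open PrimeSubfield F using (lincomb; module BasisCoordinates)
  open BasisCoordinates p-prime p↦0 B
  open PrimeSubfield.Basis B using (vector)
  open FourthRoot F ω ω-generator q%4≡1 using (i; i*i≡-1; 1≢-1; i^k*i^k≡±1)
  open Matrices F

  P : Mat
  P = proj₁ (unimodularCompletion π π≢0)

  column₁-P : column₁ P ≡ π
  column₁-P = proj₁ (proj₂ (unimodularCompletion π π≢0))

  open Conjugation P (proj₂ (proj₂ (unimodularCompletion π π≢0)))

  act-P : ∀ x → act P (x , 0#) ≡ scale x π
  act-P x = trans (act-column₁ P x) (cong (scale x) column₁-P)

  record Triangular (M : Mat) : Set where
    field
      exponent   : ℕ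
      diagonal   : Mat.a M ≡ i ^ exponent
      lower-zero : Mat.c M ≡ 0#
      unimodular : det M ≡ 1#

  triangular-conj : ∀ {g} → InStab ω π g → Triangular (conj g)
  triangular-conj {g} (det-g≡1 , k , gπ≡i^kπ) = record
    { exponent = k ; diagonal = cong proj₁ column ; lower-zero = cong proj₂ column
    ; unimodular = trans (det-conj g) det-g≡1 }
    where
      open ≡-Reasoning
      column : column₁ (conj g) ≡ (i ^ k , 0#)
      column = act-P-injective (begin
        act P (column₁ (conj g))   ≡⟨ act-conj g ⟩
        act g (column₁ P)          ≡⟨ cong (act g) column₁-P ⟩
        act g π                    ≡⟨ gπ≡i^kπ ⟩
        scale (i ^ k) π            ≡⟨ act-P (i ^ k) ⟨
        act P (i ^ k , 0#)         ∎)

  inStab-unconj : ∀ {M} → Triangular M → InStab ω π (unconj M)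
  inStab-unconj {M} T = det-unconj , exponent , (begin
    act (unconj M) π                    ≡⟨ cong (act (unconj M)) column₁-P ⟨
    act (unconj M) (column₁ P)          ≡⟨ act-conj (unconj M) ⟨
    act P (column₁ (conj (unconj M)))   ≡⟨ cong (λ N → act P (column₁ N)) (conj-unconj M) ⟩
    act P (column₁ M)                   ≡⟨ cong (act P) (cong₂ _,_ diagonal lower-zero) ⟩
    act P (i ^ exponent , 0#)           ≡⟨ act-P (i ^ exponent) ⟩
    scale (i ^ exponent) π              ∎)
    where
      open Triangular T
      open ≡-Reasoning
      det-unconj : det (unconj M) ≡ 1#
      det-unconj = trans (sym (det-conj (unconj M))) (trans (cong det (conj-unconj M)) unimodular)

  -- The coordinates in C_p^α ⋊ C₂ of [[a, b], [0, a⁻¹]]: b·a (not b) is the one that composes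
  -- additively, twisted by a² = ±1.
  translation : Mat → Carrier
  translation M = Mat.b M * Mat.a M

  sign : Mat → Bool
  sign M = does (Mat.a M * Mat.a M ≟ - 1#)

  sign-unique : ∀ {M} s → Mat.a M * Mat.a M ≡ ±1 s → sign M ≡ s
  sign-unique s a²≡±1 = trans (cong (λ x → does (x ≟ - 1#)) a²≡±1) (≟-±1 1≢-1 s)

  module _ {M : Mat} (T : Triangular M) where
    open Triangular T

    triangular-ad≡1 : Mat.a M * Mat.d M ≡ 1#
    triangular-ad≡1 = trans (sym (begin
      Mat.a M * Mat.d M + - (Mat.b M * Mat.c M)   ≡⟨ cong (λ c → Mat.a M * Mat.d M + - (Mat.b M * c)) lower-zero ⟩
      Mat.a M * Mat.d M + - (Mat.b M * 0#)        ≡⟨ solve 3 (λ a b d → a :* d :+ :- (b :* con (ℤ.+ 0)) := a :* d) refl (Mat.a M) (Mat.b M) (Mat.d M) ⟩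
      Mat.a M * Mat.d M                           ∎)) unimodular
      where open ≡-Reasoning

    triangular-a≢0 : Mat.a M ≢ 0#
    triangular-a≢0 a≡0 = 1≢0 (trans (sym triangular-ad≡1) (trans (cong (_* Mat.d M) a≡0) (zeroˡ _)))

    triangular-square : Mat.a M * Mat.a M ≡ ±1 (sign M)
    triangular-square = ±1-≟ _ (subst (λ x → x * x ≡ 1# ⊎ x * x ≡ - 1#) (sym diagonal) (i^k*i^k≡±1 exponent))

  translation-· : ∀ {M N} → Triangular M → Triangular N →
                  translation (M · N) ≡ translation M + ±1 (sign M) * translation N
  translation-· {mat a b c d} {mat a' b' c' d'} TM TN = begin
    (a * b' + b * d') * (a * a' + b * c')      ≡⟨ cong (λ z → (a * b' + b * d') * (a * a' + b * z)) (Triangular.lower-zero TN) ⟩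
    (a * b' + b * d') * (a * a' + b * 0#)     ≡⟨ solve 5 (λ a b a' b' d' → (a :* b' :+ b :* d') :* (a :* a' :+ b :* con (ℤ.+ 0))
                                                    := (b :* a) :* (a' :* d') :+ (a :* a) :* (b' :* a')) refl a b a' b' d' ⟩
    (b * a) * (a' * d') + (a * a) * (b' * a') ≡⟨ cong₂ (λ x y → (b * a) * x + y * (b' * a')) (triangular-ad≡1 TN) (triangular-square TM) ⟩
    (b * a) * 1# + ±1 s * (b' * a')           ≡⟨ cong (_+ ±1 s * (b' * a')) (*-identityʳ (b * a)) ⟩
    b * a + ±1 s * (b' * a')                  ∎
    where open ≡-Reasoning
          s : Bool
          s = sign (mat a b c d)

  sign-· : ∀ {M N} → Triangular M → Triangular N → sign (M · N) ≡ sign M xor sign N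
  sign-· {mat a b c d} {mat a' b' c' d'} TM TN = sign-unique {mat a b c d · mat a' b' c' d'} (s xor s') (begin
    (a * a' + b * c') * (a * a' + b * c')     ≡⟨ cong (λ z → (a * a' + b * z) * (a * a' + b * z)) (Triangular.lower-zero TN) ⟩
    (a * a' + b * 0#) * (a * a' + b * 0#)     ≡⟨ solve 3 (λ a b a' → (a :* a' :+ b :* con (ℤ.+ 0)) :* (a :* a' :+ b :* con (ℤ.+ 0))
                                                    := (a :* a) :* (a' :* a')) refl a b a' ⟩
    (a * a) * (a' * a')                       ≡⟨ cong₂ _*_ (triangular-square TM) (triangular-square TN) ⟩
    ±1 s * ±1 s'                              ≡⟨ ±1-xor s s' ⟩
    ±1 (s xor s')                             ∎)
    where open ≡-Reasoning
          s : Bool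
          s = sign (mat a b c d)
          s' : Bool
          s' = sign (mat a' b' c' d')

  translation-negM : ∀ M → translation (negM M) ≡ translation M
  translation-negM M = solve 2 (λ a b → (:- b) :* (:- a) := b :* a) refl (Mat.a M) (Mat.b M)

  sign-negM : ∀ M → sign (negM M) ≡ sign M
  sign-negM M = cong (λ x → does (x ≟ - 1#)) (solve 1 (λ a → (:- a) :* (:- a) := a :* a) refl (Mat.a M))

  triangular-scaled : ∀ {M N} → Triangular M → Triangular N → translation N ≡ translation M →
                      ∀ ε → ε * ε ≡ 1# → Mat.a N ≡ ε * Mat.a M → N ≡ scaleM ε M
  triangular-scaled {mat a b c d} {mat a' b' c' d'} TM TN tN≡tM ε ε²≡1 a'≡εa =
    mat-cong a'≡εa
      (*-cancelˡ (triangular-a≢0 TM) (begin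
        a * b'                  ≡⟨ ε²-cancel (a * b') ⟩
        ε * (ε * (a * b'))      ≡⟨ cong (ε *_) (solve 3 (λ ε a b' → ε :* (a :* b') := b' :* (ε :* a)) refl ε a b') ⟩
        ε * (b' * (ε * a))      ≡⟨ cong (λ z → ε * (b' * z)) a'≡εa ⟨
        ε * (b' * a')           ≡⟨ cong (ε *_) tN≡tM ⟩
        ε * (b * a)             ≡⟨ solve 3 (λ ε a b → ε :* (b :* a) := a :* (ε :* b)) refl ε a b ⟩
        a * (ε * b)             ∎))
      (trans (Triangular.lower-zero TN) (sym (trans (cong (ε *_) (Triangular.lower-zero TM)) (zeroʳ ε))))
      (*-cancelˡ (triangular-a≢0 TM) (begin
        a * d'                  ≡⟨ ε²-cancel (a * d') ⟩
        ε * (ε * (a * d'))      ≡⟨ cong (ε *_) (sym (*-assoc ε a d')) ⟩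
        ε * ((ε * a) * d')      ≡⟨ cong (λ z → ε * (z * d')) a'≡εa ⟨
        ε * (a' * d')           ≡⟨ cong (ε *_) (trans (triangular-ad≡1 TN) (sym (triangular-ad≡1 TM))) ⟩
        ε * (a * d)             ≡⟨ solve 3 (λ ε a d → ε :* (a :* d) := a :* (ε :* d)) refl ε a d ⟩
        a * (ε * d)             ∎))
    where
      open ≡-Reasoning
      ε²-cancel : ∀ x → x ≡ ε * (ε * x)
      ε²-cancel x = trans (sym (*-identityˡ x)) (trans (cong (_* x) (sym ε²≡1)) (*-assoc ε ε x))

  triangular-injective : ∀ {M N} → Triangular M → Triangular N → translation N ≡ translation M →
                         sign N ≡ sign M → N ≡ M ⊎ N ≡ negM M
  triangular-injective {M} {N} TM TN tN≡tM sN≡sM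
    with x*x≡y*y⇒x≡±y (Mat.a N) (Mat.a M)
           (trans (triangular-square TN) (trans (cong ±1 sN≡sM) (sym (triangular-square TM))))
  ... | inj₁ a'≡a  = inj₁ (trans (triangular-scaled TM TN tN≡tM 1# (*-identityˡ 1#) (trans a'≡a (sym (*-identityˡ _))))
                                 (scaleM-1 M))
  ... | inj₂ a'≡-a = inj₂ (trans (triangular-scaled TM TN tN≡tM (- 1#) (trans (-1*x≈-x (- 1#)) (⁻¹-involutive 1#))
                                                     (trans a'≡-a (sym (-1*x≈-x _))))
                                 (scaleM-[-1] M))

  triangular-with-diagonal : ∀ t k y {s} → i ^ k * y ≡ 1# → i ^ k * i ^ k ≡ ±1 s →
                             Σ Mat λ M → Triangular M × translation M ≡ t × sign M ≡ s
  triangular-with-diagonal t k y {s} xy≡1 x²≡±1 = M , T , translation≡t , sign-unique {M} s x²≡±1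
    where
      x : Carrier
      x = i ^ k
      M : Mat
      M = mat x (t * y) 0# y
      open ≡-Reasoning
      T : Triangular M
      T = record { exponent = k ; diagonal = refl ; lower-zero = refl ; unimodular = begin
        x * y + - ((t * y) * 0#)   ≡⟨ solve 3 (λ x y t → x :* y :+ :- ((t :* y) :* con (ℤ.+ 0)) := x :* y) refl x y t ⟩
        x * y                      ≡⟨ xy≡1 ⟩
        1#                         ∎ }
      translation≡t : (t * y) * x ≡ t
      translation≡t = begin
        (t * y) * x                ≡⟨ solve 3 (λ t x y → (t :* y) :* x := t :* (x :* y)) refl t x y ⟩
        t * (x * y)                ≡⟨ cong (t *_) xy≡1 ⟩
        t * 1#                     ≡⟨ *-identityʳ t ⟩
        t                          ∎

  triangular-surjective : ∀ t s → Σ Mat λ M → Triangular M × translation M ≡ t × sign M ≡ s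
  triangular-surjective t false = triangular-with-diagonal t 0 1# (*-identityˡ 1#) (*-identityˡ 1#)
  triangular-surjective t true  = triangular-with-diagonal t 1 (- i)
    (trans (solve 2 (λ i o → (i :* o) :* (:- i) := :- (i :* i) :* o) refl i 1#)
           (trans (cong (λ z → - z * 1#) i*i≡-1) (trans (*-identityʳ _) (⁻¹-involutive 1#))))
    (trans (cong₂ _*_ (*-identityʳ i) (*-identityʳ i)) i*i≡-1)

  toSD : Mat → SDCarrier α
  toSD M = coordinates (translation M) , sign M

  toSD-hom : ∀ g h → InStab ω π g → InStab ω π h →
             _≈SD_ {p} (toSD (conj (g · h))) (toSD (conj g) ∙SD toSD (conj h))
  toSD-hom g h g∈G h∈G =
    coordinates-twist (sign (conj g)) (translation (conj g)) (translation (conj h))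
      (trans (cong translation (conj-· g h)) (translation-· (triangular-conj g∈G) (triangular-conj h∈G))) ,
    trans (cong sign (conj-· g h)) (sign-· (triangular-conj g∈G) (triangular-conj h∈G))

  toSD-cong : ∀ g h → g ≈PSL h → _≈SD_ {p} (toSD (conj g)) (toSD (conj h))
  toSD-cong g h (inj₁ h≡g) = coordinates-≋ (cong (λ k → translation (conj k)) (sym h≡g)) , cong (λ k → sign (conj k)) (sym h≡g)
  toSD-cong g h (inj₂ h≡-g) =
    coordinates-≋ (sym (trans (cong (λ k → translation (conj k)) h≡-g) (trans (cong translation (conj-negM g)) (translation-negM (conj g))))) ,
    sym (trans (cong (λ k → sign (conj k)) h≡-g) (trans (cong sign (conj-negM g)) (sign-negM (conj g))))

  toSD-injective : ∀ g h → InStab ω π g → InStab ω π h → _≈SD_ {p} (toSD (conj g)) (toSD (conj h)) → g ≈PSL h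
  toSD-injective g h g∈G h∈G (tg≋th , sg≡sh) =
    Sum.map conj-injective (λ conj-h≡-conj-g → conj-injective (trans conj-h≡-conj-g (sym (conj-negM g))))
      (triangular-injective (triangular-conj g∈G) (triangular-conj h∈G) (sym (coordinates-injective tg≋th)) (sym sg≡sh))

  toSD-surjective : ∀ x → Σ Mat λ g → InStab ω π g × _≈SD_ {p} (toSD (conj g)) x
  toSD-surjective (z , s) = unconjugate (triangular-surjective (lincomb vector z) s)
    where
      unconjugate : (Σ Mat λ M → Triangular M × translation M ≡ lincomb vector z × sign M ≡ s) →
                    Σ Mat λ g → InStab ω π g × _≈SD_ {p} (toSD (conj g)) (z , s)
      unconjugate (M , T , tM≡z , sM≡s) = unconj M , inStab-unconj T ,
        coordinates-lincomb z (trans (cong translation (conj-unconj M)) tM≡z) ,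
        trans (cong sign (conj-unconj M)) sM≡s

  stabiliserIso : StabIso F ω π p α
  stabiliserIso = record
    { f      = λ g → toSD (conj g)
    ; f-cong = λ g h _ _ → toSD-cong g h
    ; f-hom  = toSD-hom
    ; f-inj  = toSD-injective
    ; f-surj = toSD-surjective
    }

open import Data.Nat using (_^_)

lemma2p3 : (p α q : ℕ) → Prime p → q ≡ p ^ α → q % 4 ≡ 1 →
    (F : FiniteField q) → (ω : FiniteField.Carrier F) →
    FieldOps.IsGenerator F ω →
    (π : FieldOps.Vec2 F) → FieldOps.NonZeroVec F π →
    StabIso F ω π p α
lemma2p3 p α q p-prime q≡p^α q%4≡1 F ω ω-generator π π≢0 =
  let (p↦0 , B) = PrimeSubfield.primeBasis F p α p-prime q≡p^α
  in Stabiliser.stabiliserIso F ω ω-generator q%4≡1 p-prime p↦0 B π π≢0
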